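{- Let $q,k,\ell$ be positive integers with $\ell\le k$. The following are equivalent: (1) $\mathcal{E}(q,k,\ell)=q^\ell/k$; (2) the vertex set of $\mathrm{dB}(q,\ell)$ can be partitioned into pairwise vertex-disjoint directed cycles each of length $k$; (3) the edge set of $\mathrm{dB}(q,\ell-1)$ can be partitioned into pairwise edge-disjoint $k$-circuits.
   Context: For integers $q\ge1$, $m\ge 0$, the de Bruijn graph $\mathrm{dB}(q,m)$ is the directed graph with vertex set $\mathbb{Z}_q^m$ (words of length $m$) and one edge for each word $a_0a_1\dots a_m\in\mathbb{Z}_q^{m+1}$, going from $a_0a_1\dots a_{m-1}$ to $a_1a_2\dots a_m$ (loops allowed; for $m\ge1$ this is a simple digraph with loops, and $\mathrm{dB}(q,0)$ is a single vertex with $q$ loops). A $k$-circuit is a closed directed walk with $k$ edges and no repeated edge (vertices may repeat). A $k$-cycle is a closed directed walk of length $k$ with no repeated vertex. A colouring of $n$ eBugs is an $n$-tuple of words $w_1,\dots,w_n\in\mathbb{Z}_q^k$ (positions read modulo $k$). It is $\ell$-valid if the $nk$ cyclic windows $(w_j(i),\dots,w_j(i+\ell-1))\in\mathbb{Z}_q^\ell$ (positions modulo $k$), for $1\le j\le n$, $0\le i<k$, are pairwise distinct. The eBug number $\mathcal{E}(q,k,\ell)$ is the maximum $n$ for which an $\ell$-valid colouring of $n$ eBugs exists. -}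

module Defs where

open import Data.Nat using (ℕ; zero; suc; _+_; _*_; _∸_; _^_; _≤_; NonZero)
open import Data.Nat.DivMod using (_mod_)
open import Data.Fin using (Fin; toℕ)
open import Data.Vec using (Vec; init; tail; lookup; tabulate)
open import Data.Product using (Σ; ∃; _×_; _,_)
open import Relation.Binary.PropositionalEquality using (_≡_)

sucMod : (k : ℕ) .{{_ : NonZero k}} → Fin k → Fin k
sucMod k i = suc (toℕ i) mod k

IsBijective : {A : Set} {N k : ℕ} → (Fin N × Fin k → A) → Set
IsBijective {A} {N} {k} f =
  ((x y : Fin N × Fin k) → f x ≡ f y → x ≡ y) × ((a : A) → ∃ λ x → f x ≡ a)

Vertex : ℕ → ℕ → Set
Vertex q m = Vec (Fin q) m

-- Edges: words a₀…a_m of length m+1, going from a₀…a_{m-1} to a₁…a_m.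
Edge : ℕ → ℕ → Set
Edge q m = Vec (Fin q) (suc m)

source : {q m : ℕ} → Edge q m → Vertex q m
source e = init e

target : {q m : ℕ} → Edge q m → Vertex q m
target e = tail e

IsClosedWalk : (q m k : ℕ) .{{_ : NonZero k}} → (Fin k → Edge q m) → Set
IsClosedWalk q m k e = (i : Fin k) → target (e i) ≡ source (e (sucMod k i))

IsCircuit : (q m k : ℕ) .{{_ : NonZero k}} → (Fin k → Edge q m) → Set
IsCircuit q m k e =
  IsClosedWalk q m k e × ((i j : Fin k) → e i ≡ e j → i ≡ j)

IsCycle : (q m k : ℕ) .{{_ : NonZero k}} → (Fin k → Edge q m) → Set
IsCycle q m k e =
  IsClosedWalk q m k e × ((i j : Fin k) → source (e i) ≡ source (e j) → i ≡ j)

VertexPartitionIntoCycles : (q m k : ℕ) .{{_ : NonZero k}} → Set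
VertexPartitionIntoCycles q m k =
  Σ ℕ λ N → Σ (Fin N → Fin k → Edge q m) λ C →
    ((j : Fin N) → IsCycle q m k (C j)) ×
    IsBijective {Vertex q m} {N} {k} (λ { (j , i) → source (C j i) })

EdgePartitionIntoCircuits : (q m k : ℕ) .{{_ : NonZero k}} → Set
EdgePartitionIntoCircuits q m k =
  Σ ℕ λ N → Σ (Fin N → Fin k → Edge q m) λ C →
    ((j : Fin N) → IsCircuit q m k (C j)) ×
    IsBijective {Edge q m} {N} {k} (λ { (j , i) → C j i })

Colouring : (q k n : ℕ) → Set
Colouring q k n = Fin n → Vec (Fin q) k

window : {q k n : ℕ} .{{_ : NonZero k}} → (ℓ : ℕ) → Colouring q k n →
         Fin n → Fin k → Vec (Fin q) ℓ
window {k = k} ℓ w j i = tabulate (λ t → lookup (w j) ((toℕ i + toℕ t) mod k))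

IsValid : (q k ℓ n : ℕ) .{{_ : NonZero k}} → Colouring q k n → Set
IsValid q k ℓ n w =
  (j j' : Fin n) (i i' : Fin k) → window ℓ w j i ≡ window ℓ w j' i' →
    (j , i) ≡ (j' , i')

HasValidColouring : (q k ℓ n : ℕ) .{{_ : NonZero k}} → Set
HasValidColouring q k ℓ n = Σ (Colouring q k n) (IsValid q k ℓ n)

EBugNumberIs : (q k ℓ : ℕ) .{{_ : NonZero k}} → ℕ → Set
EBugNumberIs q k ℓ n =
  HasValidColouring q k ℓ n × ((m : ℕ) → HasValidColouring q k ℓ m → m ≤ n)

-- The ℓ-windows of an eBug word of length k are the vertices of a closed walk of
-- length k in dB(q,ℓ) whose edges are its (ℓ+1)-windows, and conversely a closed
-- walk in dB(q,ℓ) is recovered from the word of first letters of its vertices.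
-- An ℓ-valid colouring of n eBugs is therefore the same thing as n vertex-disjoint
-- k-cycles in dB(q,ℓ), so nk ≤ q^ℓ, with equality exactly when the cycles cover
-- every vertex.  Finally the vertices and edges of dB(q,ℓ) are the edges and the
-- pairs of consecutive edges of dB(q,ℓ-1), which turns k-cycles of dB(q,ℓ) into
-- k-circuits of dB(q,ℓ-1) and back.
module Submission where

open import Defs
open import Data.Nat using (ℕ; _*_; _∸_; _^_; _≤_; NonZero)
open import Data.Product using (Σ; _×_)
open import Relation.Binary.PropositionalEquality using (_≡_)
open import Function.Bundles using (_⇔_)

open import Data.Nat using (zero; suc; _+_; _%_)
open import Data.Nat.Properties using (<-irrefl; +-suc; +-identityʳ; ≤-antisym; ≤-trans; ≤-reflexive; *-cancelʳ-≤)
open import Data.Nat.DivMod using (_mod_; %-distribˡ-+; m%n%n≡m%n; m<n⇒m%n≡m)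
open import Data.Fin using (Fin; toℕ; inject₁; punchOut)
open import Data.Fin.Properties
  using (toℕ-injective; toℕ-fromℕ<; toℕ<n; toℕ-inject₁; *↔×; injective⇒≤; punchOut-injective; any?; _≟_)
open import Data.Vec using (Vec; []; _∷_; head; tail; init; lookup; tabulate)
open import Data.Vec.Properties using (lookup∘tabulate; tabulate∘lookup; tabulate-cong)
open import Data.Product using (_,_; proj₁; proj₂; uncurry)
open import Data.Empty using (⊥-elim)
open import Function using (_∘_; Injective; StrictlySurjective; Inverse; _↔_; mk↔ₛ′; mk⇔)
open import Function.Properties.Inverse using (↔-sym; ↔-trans; ↔-refl)
open import Data.Product.Function.NonDependent.Propositional using (_×-↔_)
open import Relation.Binary.PropositionalEquality using (_≢_; refl; sym; trans; cong; module ≡-Reasoning)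
open import Relation.Nullary using (yes; no)

open ≡-Reasoning

Fin-injective⇒surjective : ∀ {n} {f : Fin n → Fin n} → Injective _≡_ _≡_ f → StrictlySurjective _≡_ f
Fin-injective⇒surjective {suc n} {f} f-inj y with any? (λ x → f x ≟ y)
... | yes hit = hit
... | no miss = ⊥-elim (<-irrefl refl (injective⇒≤ punched-injective))
  where
  -- if y were missed, f would inject Fin (suc n) into Fin (suc n) ∖ {y} ≅ Fin n
  y≢f : ∀ x → y ≢ f x
  y≢f x y≡fx = miss (x , sym y≡fx)
  punched : Fin (suc n) → Fin n
  punched x = punchOut (y≢f x)
  punched-injective : Injective _≡_ _≡_ punched
  punched-injective = f-inj ∘ punchOut-injective (y≢f _) (y≢f _)

module _ {A B : Set} {a b : ℕ} (A↔ : A ↔ Fin a) (B↔ : B ↔ Fin b) {f : A → B} (f-inj : Injective _≡_ _≡_ f) where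
  private
    module A = Inverse A↔
    module B = Inverse B↔

    f̂ : Fin a → Fin b
    f̂ = B.to ∘ f ∘ A.from

    f̂-injective : Injective _≡_ _≡_ f̂
    f̂-injective {x} {y} eq = begin
      x                  ≡⟨ sym (A.strictlyInverseˡ x) ⟩
      A.to (A.from x)    ≡⟨ cong A.to (f-inj (B-to-injective eq)) ⟩
      A.to (A.from y)    ≡⟨ A.strictlyInverseˡ y ⟩
      y                  ∎
      where
      B-to-injective : ∀ {u v} → B.to u ≡ B.to v → u ≡ v
      B-to-injective {u} {v} e =
        trans (sym (B.strictlyInverseʳ u)) (trans (cong B.from e) (B.strictlyInverseʳ v))

  ↔Fin-injective⇒≤ : a ≤ b
  ↔Fin-injective⇒≤ = injective⇒≤ f̂-injective

  ↔Fin-injective⇒surjective : a ≡ b → StrictlySurjective _≡_ f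
  ↔Fin-injective⇒surjective refl y with Fin-injective⇒surjective f̂-injective (B.to y)
  ... | x , f̂x≡y = A.from x , (begin
    f (A.from x)          ≡⟨ sym (B.strictlyInverseʳ _) ⟩
    B.from (f̂ x)          ≡⟨ cong B.from f̂x≡y ⟩
    B.from (B.to y)       ≡⟨ B.strictlyInverseʳ y ⟩
    y                     ∎)

Vec-suc↔× : ∀ {A : Set} {n} → Vec A (suc n) ↔ (A × Vec A n)
Vec-suc↔× = mk↔ₛ′ (λ { (x ∷ xs) → x , xs }) (uncurry _∷_) (λ _ → refl) (λ { (x ∷ xs) → refl })

Vec-Fin↔Fin-^ : ∀ q ℓ → Vec (Fin q) ℓ ↔ Fin (q ^ ℓ)
Vec-Fin↔Fin-^ q zero    = mk↔ₛ′ (λ _ → Fin.zero) (λ _ → []) (λ { Fin.zero → refl ; (Fin.suc ()) }) (λ { [] → refl })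
Vec-Fin↔Fin-^ q (suc ℓ) = ↔-trans Vec-suc↔× (↔-trans (↔-refl ×-↔ Vec-Fin↔Fin-^ q ℓ) (↔-sym *↔×))

module _ {q N k ℓ : ℕ} {f : Fin N × Fin k → Vec (Fin q) ℓ} where

  grid-injective⇒*≤^ : Injective _≡_ _≡_ f → N * k ≤ q ^ ℓ
  grid-injective⇒*≤^ = ↔Fin-injective⇒≤ (↔-sym *↔×) (Vec-Fin↔Fin-^ q ℓ)

  grid-injective⇒surjective : N * k ≡ q ^ ℓ → Injective _≡_ _≡_ f → StrictlySurjective _≡_ f
  grid-injective⇒surjective eq f-inj = ↔Fin-injective⇒surjective (↔-sym *↔×) (Vec-Fin↔Fin-^ q ℓ) f-inj eq

  grid-bijective⇒*≡^ : IsBijective f → N * k ≡ q ^ ℓ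
  grid-bijective⇒*≡^ (f-inj , f-surj) = ≤-antisym
    (grid-injective⇒*≤^ (f-inj _ _))
    (↔Fin-injective⇒≤ (Vec-Fin↔Fin-^ q ℓ) (↔-sym *↔×) section-injective)
    where
    section-injective : Injective _≡_ _≡_ (proj₁ ∘ f-surj)
    section-injective {u} {v} eq =
      trans (sym (proj₂ (f-surj u))) (trans (cong f eq) (proj₂ (f-surj v)))

IsBijective-cong : ∀ {A : Set} {N k} {f g : Fin N × Fin k → A} →
                   (∀ x → f x ≡ g x) → IsBijective f → IsBijective g
IsBijective-cong f≗g (f-inj , f-surj) =
  (λ x y gx≡gy → f-inj x y (trans (f≗g x) (trans gx≡gy (sym (f≗g y))))) ,
  (λ a → proj₁ (f-surj a) , trans (sym (f≗g _)) (proj₂ (f-surj a)))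

init-tabulate : ∀ {A : Set} {n} (f : Fin (suc n) → A) → init (tabulate f) ≡ tabulate (f ∘ inject₁)
init-tabulate {n = zero}  f = refl
init-tabulate {n = suc n} f = cong (f Fin.zero ∷_) (init-tabulate (f ∘ Fin.suc))

tail-init : ∀ {A : Set} {n} (xs : Vec A (suc (suc n))) → tail (init xs) ≡ init (tail xs)
tail-init (x ∷ xs) = refl

head-init : ∀ {A : Set} {n} (xs : Vec A (suc (suc n))) → head (init xs) ≡ head xs
head-init (x ∷ xs) = refl

head∷tail : ∀ {A : Set} {n} (xs : Vec A (suc n)) → head xs ∷ tail xs ≡ xs
head∷tail (x ∷ xs) = refl

lookup-head : ∀ {A : Set} {n} (xs : Vec A (suc n)) → lookup xs Fin.zero ≡ head xs
lookup-head (x ∷ xs) = refl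

lookup-tail : ∀ {A : Set} {n} (xs : Vec A (suc n)) (t : Fin n) → lookup (tail xs) t ≡ lookup xs (Fin.suc t)
lookup-tail (x ∷ xs) t = refl

module _ {k : ℕ} .{{_ : NonZero k}} where

  infixl 6 _⊕_
  _⊕_ : Fin k → ℕ → Fin k
  i ⊕ n = (toℕ i + n) mod k

  ⊕-zero : (i : Fin k) → i ⊕ 0 ≡ i
  ⊕-zero i = toℕ-injective (begin
    toℕ (i ⊕ 0)        ≡⟨ toℕ-fromℕ< _ ⟩
    (toℕ i + 0) % k    ≡⟨ cong (_% k) (+-identityʳ (toℕ i)) ⟩
    toℕ i % k          ≡⟨ m<n⇒m%n≡m (toℕ<n i) ⟩
    toℕ i              ∎)

  sucMod-⊕ : (i : Fin k) (n : ℕ) → sucMod k i ⊕ n ≡ i ⊕ suc n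
  sucMod-⊕ i n = toℕ-injective (begin
    toℕ (sucMod k i ⊕ n)                    ≡⟨ toℕ-fromℕ< _ ⟩
    (toℕ (sucMod k i) + n) % k              ≡⟨ cong (λ s → (s + n) % k) (toℕ-fromℕ< _) ⟩
    (suc (toℕ i) % k + n) % k               ≡⟨ %-distribˡ-+ (suc (toℕ i) % k) n k ⟩
    (suc (toℕ i) % k % k + n % k) % k       ≡⟨ cong (λ s → (s + n % k) % k) (m%n%n≡m%n (suc (toℕ i)) k) ⟩
    (suc (toℕ i) % k + n % k) % k           ≡⟨ sym (%-distribˡ-+ (suc (toℕ i)) n k) ⟩
    (suc (toℕ i) + n) % k                   ≡⟨ cong (_% k) (sym (+-suc (toℕ i) n)) ⟩
    (toℕ i + suc n) % k                     ≡⟨ sym (toℕ-fromℕ< _) ⟩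
    toℕ (i ⊕ suc n)                         ∎)

module _ {q k : ℕ} .{{_ : NonZero k}} where

  sources-closedWalk : ∀ {m} (e : Fin k → Edge q (suc m)) →
                       IsClosedWalk q (suc m) k e → IsClosedWalk q m k (source ∘ e)
  sources-closedWalk e walk i = trans (tail-init (e i)) (cong init (walk i))

  closedWalk-lookup : ∀ {m} (e : Fin k → Edge q m) → IsClosedWalk q m k e →
                      ∀ i (t : Fin (suc m)) → lookup (e i) t ≡ head (e (i ⊕ toℕ t))
  closedWalk-lookup e walk i Fin.zero = begin
    lookup (e i) Fin.zero    ≡⟨ lookup-head (e i) ⟩
    head (e i)               ≡⟨ cong (head ∘ e) (sym (⊕-zero i)) ⟩
    head (e (i ⊕ 0))         ∎
  closedWalk-lookup {suc m} e walk i (Fin.suc t) = begin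
    lookup (e i) (Fin.suc t)                   ≡⟨ sym (lookup-tail (e i) t) ⟩
    lookup (tail (e i)) t                      ≡⟨ cong (λ v → lookup v t) (walk i) ⟩
    lookup (init (e (sucMod k i))) t           ≡⟨ closedWalk-lookup (source ∘ e) (sources-closedWalk e walk) (sucMod k i) t ⟩
    head (init (e (sucMod k i ⊕ toℕ t)))       ≡⟨ head-init (e (sucMod k i ⊕ toℕ t)) ⟩
    head (e (sucMod k i ⊕ toℕ t))              ≡⟨ cong (head ∘ e) (sucMod-⊕ i (toℕ t)) ⟩
    head (e (i ⊕ suc (toℕ t)))                 ∎

  extend : ∀ {m} → (Fin k → Edge q m) → Fin k → Edge q (suc m)
  extend e i = head (e i) ∷ e (sucMod k i)

  source-extend : ∀ {m} (e : Fin k → Edge q m) → IsClosedWalk q m k e → ∀ i → source (extend e i) ≡ e i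
  source-extend e walk i = begin
    head (e i) ∷ init (e (sucMod k i))   ≡⟨ cong (head (e i) ∷_) (sym (walk i)) ⟩
    head (e i) ∷ tail (e i)              ≡⟨ head∷tail (e i) ⟩
    e i                                  ∎

  extend-closedWalk : ∀ {m} (e : Fin k → Edge q m) → IsClosedWalk q m k e → IsClosedWalk q (suc m) k (extend e)
  extend-closedWalk e walk i = sym (source-extend e walk (sucMod k i))

module _ {q k n : ℕ} .{{_ : NonZero k}} (w : Colouring q k n) (j : Fin n) where

  source-window : ∀ ℓ i → source (window (suc ℓ) w j i) ≡ window ℓ w j i
  source-window ℓ i = trans (init-tabulate (λ t → lookup (w j) (i ⊕ toℕ t)))
    (tabulate-cong (λ t → cong (λ s → lookup (w j) ((toℕ i + s) mod k)) (toℕ-inject₁ t)))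

  target-window : ∀ ℓ i → target (window (suc ℓ) w j i) ≡ window ℓ w j (sucMod k i)
  target-window ℓ i = tabulate-cong (λ t → cong (lookup (w j)) (sym (sucMod-⊕ i (toℕ t))))

  window-closedWalk : ∀ ℓ → IsClosedWalk q ℓ k (window (suc ℓ) w j)
  window-closedWalk ℓ i = trans (target-window ℓ i) (sym (source-window ℓ (sucMod k i)))

firstLetters : ∀ {q k n m} → (Fin n → Fin k → Edge q m) → Colouring q k n
firstLetters C j = tabulate (head ∘ C j)

window-firstLetters : ∀ {q k n m} .{{_ : NonZero k}} (C : Fin n → Fin k → Edge q m) (j : Fin n) →
                      IsClosedWalk q m k (C j) → ∀ i → window (suc m) (firstLetters C) j i ≡ C j i
window-firstLetters C j walk i = begin
  tabulate (λ t → lookup (tabulate (head ∘ C j)) (i ⊕ toℕ t))   ≡⟨ tabulate-cong (λ t → lookup∘tabulate (head ∘ C j) (i ⊕ toℕ t)) ⟩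
  tabulate (λ t → head (C j (i ⊕ toℕ t)))                     ≡⟨ tabulate-cong (λ t → sym (closedWalk-lookup (C j) walk i t)) ⟩
  tabulate (lookup (C j i))                                   ≡⟨ tabulate∘lookup (C j i) ⟩
  C j i                                                       ∎

valid⇒*≤^ : ∀ {q k ℓ n} .{{_ : NonZero k}} → HasValidColouring q k ℓ n → n * k ≤ q ^ ℓ
valid⇒*≤^ {ℓ = ℓ} (w , valid) = grid-injective⇒*≤^ {f = uncurry (window ℓ w)} (valid _ _ _ _)

module _ {q k m : ℕ} .{{_ : NonZero k}} where

  perfectColouring⇒cycles : (Σ ℕ λ n → EBugNumberIs q k (suc m) n × n * k ≡ q ^ suc m) →
                            VertexPartitionIntoCycles q (suc m) k
  perfectColouring⇒cycles (n , ((w , valid) , _) , n*k≡q^ℓ) =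
    n , C , (λ j → window-closedWalk w j (suc m) , cycle-injective j) , (windows-injective , windows-surjective)
    where
    C : Fin n → Fin k → Edge q (suc m)
    C j = window (suc (suc m)) w j
    windows-injective : ∀ x y → source (uncurry C x) ≡ source (uncurry C y) → x ≡ y
    windows-injective (j , i) (j′ , i′) eq =
      valid j j′ i i′ (trans (sym (source-window w j _ i)) (trans eq (source-window w j′ _ i′)))
    cycle-injective : ∀ j i i′ → source (C j i) ≡ source (C j i′) → i ≡ i′
    cycle-injective j i i′ = cong proj₂ ∘ windows-injective (j , i) (j , i′)
    windows-surjective : StrictlySurjective _≡_ (source ∘ uncurry C)
    windows-surjective = grid-injective⇒surjective n*k≡q^ℓ (windows-injective _ _)

  cycles⇒perfectColouring : VertexPartitionIntoCycles q (suc m) k →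
                            Σ ℕ λ n → EBugNumberIs q k (suc m) n × n * k ≡ q ^ suc m
  cycles⇒perfectColouring (N , C , cycle , bijective) = N , ((w , valid) , maximal) , N*k≡q^ℓ
    where
    vertices : Fin N → Fin k → Vertex q (suc m)
    vertices j = source ∘ C j
    w : Colouring q k N
    w = firstLetters vertices
    window≡vertex : ∀ j i → window (suc m) w j i ≡ vertices j i
    window≡vertex j = window-firstLetters vertices j (sources-closedWalk (C j) (proj₁ (cycle j)))
    valid : IsValid q k (suc m) N w
    valid j j′ i i′ eq =
      proj₁ bijective (j , i) (j′ , i′) (trans (sym (window≡vertex j i)) (trans eq (window≡vertex j′ i′)))
    N*k≡q^ℓ : N * k ≡ q ^ suc m
    N*k≡q^ℓ = grid-bijective⇒*≡^ bijective
    maximal : ∀ n → HasValidColouring q k (suc m) n → n ≤ N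
    maximal n c = *-cancelʳ-≤ n N k (≤-trans (valid⇒*≤^ c) (≤-reflexive (sym N*k≡q^ℓ)))

  cycles⇒circuits : VertexPartitionIntoCycles q (suc m) k → EdgePartitionIntoCircuits q m k
  cycles⇒circuits (N , C , cycle , bijective) =
    N , (λ j → source ∘ C j) , (λ j → sources-closedWalk (C j) (proj₁ (cycle j)) , proj₂ (cycle j)) , bijective

  circuits⇒cycles : EdgePartitionIntoCircuits q m k → VertexPartitionIntoCycles q (suc m) k
  circuits⇒cycles (N , C , circuit , bijective) =
    N , (λ j → extend (C j)) , (λ j → extend-closedWalk (C j) (walk j) , cycle-injective j) ,
    IsBijective-cong (λ { (j , i) → sym (source-extend (C j) (walk j) i) }) bijective
    where
    walk : ∀ j → IsClosedWalk q m k (C j)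
    walk j = proj₁ (circuit j)
    cycle-injective : ∀ j i i′ → source (extend (C j) i) ≡ source (extend (C j) i′) → i ≡ i′
    cycle-injective j i i′ eq =
      proj₂ (circuit j) i i′ (trans (sym (source-extend (C j) (walk j) i)) (trans eq (source-extend (C j) (walk j) i′)))

proposition1 : (q k ℓ : ℕ) .{{_ : NonZero q}} .{{_ : NonZero k}} .{{_ : NonZero ℓ}} →
    ℓ ≤ k →
    ((Σ ℕ λ n → EBugNumberIs q k ℓ n × n * k ≡ q ^ ℓ) ⇔ VertexPartitionIntoCycles q ℓ k)
    × (VertexPartitionIntoCycles q ℓ k ⇔ EdgePartitionIntoCircuits q (ℓ ∸ 1) k)
proposition1 q k (suc m) _ =
  mk⇔ perfectColouring⇒cycles cycles⇒perfectColouring , mk⇔ cycles⇒circuits circuits⇒cycles
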